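{- For $l\ge0$ and $k,m\ge1$, \[\frac{1}{l!}\theta_q^l\,\frac{q^{(k-1)m}}{(1-q^m)^k}=m^l\sum_{s=0}^lT_{s,l}(k)\binom{s+k-1}{s}\frac{q^{(k+s-1)m}}{(1-q^m)^{k+s}},\] where \[T_{s,l}(k)=\frac{s!}{l!}\sum_{a=s}^l\binom{l}{a}\left\{{a\atop s}\right\}(k-1)^{l-a}.\]
   Context: $\theta_q=q\,\frac{d}{dq}$. $\left\{{a\atop s}\right\}$ is the Stirling number of the second kind, defined by $\left\{{j\atop 0}\right\}=\left\{{0\atop j}\right\}=\delta_{j,0}$ and $\left\{{j+1\atop n}\right\}=\left\{{j\atop n-1}\right\}+n\left\{{j\atop n}\right\}$. The convention $0^0=1$ is used. -}

module Defs where

open import Data.Nat as ℕ using (ℕ; zero; suc; _∸_; _^_; _!; _≟_)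
open import Data.Nat.Properties using (_!≢0)
open import Data.Nat.Combinatorics using (_C_)
open import Data.Nat.Divisibility using (_∣?_)
open import Data.Integer using (+_)
open import Data.Rational using (ℚ; 0ℚ; 1ℚ; _+_; _*_; _/_)
open import Relation.Nullary using (yes; no)

stirling2 : ℕ → ℕ → ℕ
stirling2 zero    zero    = 1
stirling2 zero    (suc n) = 0
stirling2 (suc j) zero    = 0
stirling2 (suc j) (suc n) = stirling2 j n ℕ.+ suc n ℕ.* stirling2 j (suc n)

ℕtoℚ : ℕ → ℚ
ℕtoℚ n = + n / 1

sumTo : ℕ → (ℕ → ℚ) → ℚ
sumTo zero    f = f 0
sumTo (suc n) f = sumTo n f + f (suc n)

-- Σ_{a=s}^{l} f a  (used only with s ≤ l)
sumRange : ℕ → ℕ → (ℕ → ℚ) → ℚ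
sumRange s l f = sumTo (l ∸ s) (λ i → f (s ℕ.+ i))

FPS : Set
FPS = ℕ → ℚ

_⊛_ : FPS → FPS → FPS
(f ⊛ g) n = sumTo n (λ i → f i * g (n ∸ i))

qpow : ℕ → FPS
qpow a n with n ≟ a
... | yes _ = 1ℚ
... | no  _ = 0ℚ

_^ˢ_ : FPS → ℕ → FPS
f ^ˢ zero  = qpow 0
f ^ˢ suc k = f ⊛ (f ^ˢ k)

-- 1/(1 - q^m) = Σ_j q^{m j}  (geometric series; m ≥ 1)
geom : ℕ → FPS
geom m n with m ∣? n
... | yes _ = 1ℚ
... | no  _ = 0ℚ

_·_ : ℚ → FPS → FPS
(c · f) n = c * f n

sumSeries : ℕ → (ℕ → FPS) → FPS
sumSeries l F n = sumTo l (λ s → F s n)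

-- θ_q = q d/dq on power series: coefficient of q^n is multiplied by n
θ : FPS → FPS
θ f n = ℕtoℚ n * f n

iterate : ℕ → (FPS → FPS) → FPS → FPS
iterate zero    t f = f
iterate (suc l) t f = t (iterate l t f)

-- q^{a m} / (1 - q^m)^b  as a formal power series
Q : ℕ → ℕ → ℕ → FPS
Q a b m = qpow (a ℕ.* m) ⊛ (geom m ^ˢ b)

T : ℕ → ℕ → ℕ → ℚ
T s l k = ((+ (s !) / (l !)) {{l !≢0}}) *
          sumRange s l (λ a → ℕtoℚ ((l C a) ℕ.* stirling2 a s ℕ.* (k ∸ 1) ^ (l ∸ a)))

invFact : ℕ → ℚ
invFact l = (+ 1 / (l !)) {{l !≢0}}

module Submission where

-- Both sides are power series in q^m: q^{am}/(1-q^m)^{a+1} = Σ_N C(N,a) q^{Nm}, and θ_q^l multiplies the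
-- coefficient of q^n by n^l.  With k = c + 1, comparing coefficients of q^{Nm} and clearing the factor
-- m^l/l! leaves the integer identity
--   N^l C(N,c) = Σ_s s! A_s C(s+c,s) C(N,c+s),   A_s = (l!/s!) T_{s,l}(k) = Σ_a C(l,a) {a,s} c^{l-a}.
-- For N = n + c one has C(s+c,s) C(n+c,c+s) = C(n+c,c) C(n,s), so the right side is C(N,c) Σ_s A_s n^(s),
-- with n^(s) = s! C(n,s) the falling factorial; swapping the sums, n^a = Σ_s {a,s} n^(s) and the binomial
-- theorem give Σ_a C(l,a) n^a c^{l-a} = (n + c)^l = N^l.

open import Algebra.Bundles using (CommutativeSemiring; CommutativeRing)
open import Data.Nat.Base using (ℕ; zero; suc; _≤_; _<_; _∸_; z≤n; s≤s)
open import Data.Nat.Combinatorics using (_C_)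
import Data.Nat.Base as ℕ
import Data.Nat.Properties as ℕ
import Data.Rational.Base as ℚ
import Data.Rational.Properties as ℚ
open import Data.Fin.Base using (toℕ; inject₁; fromℕ)
open import Data.Fin.Properties using (toℕ≤pred[n]; toℕ-inject₁; toℕ-fromℕ)
open import Data.Sum.Base using (inj₁; inj₂)
open import Relation.Binary.PropositionalEquality as ≡ using (_≢_)
open import Defs

module RangeSum {c ℓ} (R : CommutativeSemiring c ℓ) where

  open CommutativeSemiring R
  open import Algebra.Properties.Semiring.Sum semiring
  open import Algebra.Properties.Semiring.Mult semiring using (_×_)
  open import Algebra.Properties.CommutativeSemiring.Exp R using (_^_)
  import Algebra.Properties.CommutativeSemiring.Binomial R as Binomial
  open import Relation.Binary.Reasoning.Setoid setoid

  -- Opaque so that ∑≤ n f stays rigid and f can be inferred by unification.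
  opaque

    ∑≤ : ℕ → (ℕ → Carrier) → Carrier
    ∑≤ n f = ∑[ i ≤ n ] f (toℕ i)

    ∑≤-0 : ∀ f → ∑≤ 0 f ≈ f 0
    ∑≤-0 f = +-identityʳ (f 0)

    ∑≤-head : ∀ n f → ∑≤ (suc n) f ≈ f 0 + ∑≤ n (λ i → f (suc i))
    ∑≤-head n f = refl

    ∑≤-suc : ∀ n f → ∑≤ (suc n) f ≈ ∑≤ n f + f (suc n)
    ∑≤-suc n f = begin
      ∑≤ (suc n) f
        ≈⟨ sum-init-last (λ i → f (toℕ i)) ⟩
      ∑[ i ≤ n ] f (toℕ (inject₁ i)) + f (toℕ (fromℕ (suc n)))
        ≡⟨ ≡.cong₂ _+_ (sum-cong-≗ {suc n} (λ i → ≡.cong f (toℕ-inject₁ i))) (≡.cong f (toℕ-fromℕ (suc n))) ⟩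
      ∑≤ n f + f (suc n) ∎

    ∑≤-cong : ∀ {n f g} → (∀ i → i ≤ n → f i ≈ g i) → ∑≤ n f ≈ ∑≤ n g
    ∑≤-cong {n} f≈g = sum-cong-≋ {suc n} (λ i → f≈g (toℕ i) (toℕ≤pred[n] i))

    ∑≤-zero : ∀ {n f} → (∀ i → i ≤ n → f i ≈ 0#) → ∑≤ n f ≈ 0#
    ∑≤-zero {n} f≈0 = trans (∑≤-cong f≈0) (sum-replicate-zero (suc n))

    ∑≤-distrib-+ : ∀ n f g → ∑≤ n (λ i → f i + g i) ≈ ∑≤ n f + ∑≤ n g
    ∑≤-distrib-+ n f g = ∑-distrib-+ {suc n} (λ i → f (toℕ i)) (λ i → g (toℕ i))

    *-distribˡ-∑≤ : ∀ n x f → x * ∑≤ n f ≈ ∑≤ n (λ i → x * f i)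
    *-distribˡ-∑≤ n x f = *-distribˡ-sum {suc n} x (λ i → f (toℕ i))

    ∑≤-comm : ∀ m n (f : ℕ → ℕ → Carrier) → ∑≤ m (λ i → ∑≤ n (f i)) ≈ ∑≤ n (λ j → ∑≤ m (λ i → f i j))
    ∑≤-comm m n f = ∑-comm {suc m} {suc n} (λ i j → f (toℕ i) (toℕ j))

    binomial-theorem : ∀ n x y → (x + y) ^ n ≈ ∑≤ n (λ k → (n C k) × (x ^ k * y ^ (n ∸ k)))
    binomial-theorem = Binomial.theorem

  ∑≤-single : ∀ {n a} f → a ≤ n → (∀ i → i ≤ n → i ≢ a → f i ≈ 0#) → ∑≤ n f ≈ f a
  ∑≤-single {zero}  f z≤n _ = ∑≤-0 f
  ∑≤-single {suc n} {a} f a≤1+n f≈0 with ℕ.m≤n⇒m<n∨m≡n a≤1+n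
  ... | inj₁ (s≤s a≤n) = begin
    ∑≤ (suc n) f        ≈⟨ ∑≤-suc n f ⟩
    ∑≤ n f + f (suc n)  ≈⟨ +-cong (∑≤-single f a≤n (λ i i≤n → f≈0 i (ℕ.m≤n⇒m≤1+n i≤n)))
                                  (f≈0 (suc n) ℕ.≤-refl (λ { ≡.refl → ℕ.1+n≰n a≤n })) ⟩
    f a + 0#            ≈⟨ +-identityʳ (f a) ⟩
    f a                 ∎
  ... | inj₂ ≡.refl = begin
    ∑≤ (suc n) f        ≈⟨ ∑≤-suc n f ⟩
    ∑≤ n f + f (suc n)  ≈⟨ +-congʳ (∑≤-zero (λ i i≤n → f≈0 i (ℕ.m≤n⇒m≤1+n i≤n)
                                                          (λ { ≡.refl → ℕ.1+n≰n i≤n }))) ⟩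
    0# + f (suc n)      ≈⟨ +-identityˡ (f (suc n)) ⟩
    f (suc n)           ∎

  ∑≤-split : ∀ p q f → ∑≤ (suc p ℕ.+ q) f ≈ ∑≤ p f + ∑≤ q (λ i → f (suc p ℕ.+ i))
  ∑≤-split zero    q f = trans (∑≤-head q f) (+-congʳ (sym (∑≤-0 f)))
  ∑≤-split (suc p) q f = begin
    ∑≤ (suc (suc p) ℕ.+ q) f                                           ≈⟨ ∑≤-head (suc p ℕ.+ q) f ⟩
    f 0 + ∑≤ (suc p ℕ.+ q) (λ i → f (suc i))                           ≈⟨ +-congˡ (∑≤-split p q (λ i → f (suc i))) ⟩
    f 0 + (∑≤ p (λ i → f (suc i)) + ∑≤ q (λ i → f (suc (suc p ℕ.+ i)))) ≈⟨ +-assoc _ _ _ ⟨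
    (f 0 + ∑≤ p (λ i → f (suc i))) + ∑≤ q (λ i → f (suc (suc p ℕ.+ i))) ≈⟨ +-congʳ (∑≤-head p f) ⟨
    ∑≤ (suc p) f + ∑≤ q (λ i → f (suc (suc p) ℕ.+ i))                 ∎

  ∑≤-from : ∀ {s l} f → s ≤ l → (∀ a → a < s → f a ≈ 0#) → ∑≤ (l ∸ s) (λ i → f (s ℕ.+ i)) ≈ ∑≤ l f
  ∑≤-from {zero}          f _         _   = refl
  ∑≤-from {suc s} {suc l} f (s≤s s≤l) f≈0 = begin
    ∑≤ (l ∸ s) (λ i → f (suc s ℕ.+ i))  ≈⟨ ∑≤-from (λ i → f (suc i)) s≤l (λ a a<s → f≈0 (suc a) (s≤s a<s)) ⟩
    ∑≤ l (λ i → f (suc i))              ≈⟨ +-identityˡ _ ⟨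
    0# + ∑≤ l (λ i → f (suc i))         ≈⟨ +-congʳ (f≈0 0 (s≤s z≤n)) ⟨
    f 0 + ∑≤ l (λ i → f (suc i))        ≈⟨ ∑≤-head l f ⟨
    ∑≤ (suc l) f                        ∎

module ℕ∑ = RangeSum ℕ.+-*-commutativeSemiring

-- ℕtoℚ a and + a / suc d are fromℚᵘ of unnormalised fractions, on which these identities are integer identities.
module NatCast where

  open import Data.Integer.Base as ℤ using (+_)
  import Data.Integer.Properties as ℤ
  open import Data.Rational.Base using (_+_; _*_; _/_; fromℚᵘ)
  open import Data.Rational.Properties using (toℚᵘ-injective; toℚᵘ-fromℚᵘ; toℚᵘ-homo-+; toℚᵘ-homo-*; fromℚᵘ-cong)
  open import Data.Rational.Unnormalised.Base as ℚᵘ using (mkℚᵘ; *≡*)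
  import Data.Rational.Unnormalised.Properties as ℚᵘ
  open ≡ using (_≡_; cong)
  open ≡.≡-Reasoning

  fromℚᵘ-homo-+ : ∀ p q → fromℚᵘ (p ℚᵘ.+ q) ≡ fromℚᵘ p + fromℚᵘ q
  fromℚᵘ-homo-+ p q = toℚᵘ-injective (ℚᵘ.≃-trans (toℚᵘ-fromℚᵘ (p ℚᵘ.+ q))
    (ℚᵘ.≃-sym (ℚᵘ.≃-trans (toℚᵘ-homo-+ (fromℚᵘ p) (fromℚᵘ q))
       (ℚᵘ.+-cong (toℚᵘ-fromℚᵘ p) (toℚᵘ-fromℚᵘ q)))))

  fromℚᵘ-homo-* : ∀ p q → fromℚᵘ (p ℚᵘ.* q) ≡ fromℚᵘ p * fromℚᵘ q
  fromℚᵘ-homo-* p q = toℚᵘ-injective (ℚᵘ.≃-trans (toℚᵘ-fromℚᵘ (p ℚᵘ.* q))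
    (ℚᵘ.≃-sym (ℚᵘ.≃-trans (toℚᵘ-homo-* (fromℚᵘ p) (fromℚᵘ q))
       (ℚᵘ.*-cong (toℚᵘ-fromℚᵘ p) (toℚᵘ-fromℚᵘ q)))))

  ℕtoℚ-homo-+ : ∀ a b → ℕtoℚ (a ℕ.+ b) ≡ ℕtoℚ a + ℕtoℚ b
  ℕtoℚ-homo-+ a b = ≡.trans (fromℚᵘ-cong {mkℚᵘ (+ (a ℕ.+ b)) 0} {mkℚᵘ (+ a) 0 ℚᵘ.+ mkℚᵘ (+ b) 0} (*≡* eq))
                            (fromℚᵘ-homo-+ (mkℚᵘ (+ a) 0) (mkℚᵘ (+ b) 0))
    where
    eq : + (a ℕ.+ b) ℤ.* + 1 ≡ (+ a ℤ.* + 1 ℤ.+ + b ℤ.* + 1) ℤ.* + 1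
    eq = cong (ℤ._* + 1) (begin
      + (a ℕ.+ b)               ≡⟨ ℤ.pos-+ a b ⟩
      + a ℤ.+ + b               ≡⟨ ≡.cong₂ ℤ._+_ (ℤ.*-identityʳ (+ a)) (ℤ.*-identityʳ (+ b)) ⟨
      + a ℤ.* + 1 ℤ.+ + b ℤ.* + 1 ∎)

  ℕtoℚ-homo-* : ∀ a b → ℕtoℚ (a ℕ.* b) ≡ ℕtoℚ a * ℕtoℚ b
  ℕtoℚ-homo-* a b = ≡.trans (fromℚᵘ-cong {mkℚᵘ (+ (a ℕ.* b)) 0} {mkℚᵘ (+ a) 0 ℚᵘ.* mkℚᵘ (+ b) 0}
                                          (*≡* (cong (ℤ._* + 1) (ℤ.pos-* a b))))
                            (fromℚᵘ-homo-* (mkℚᵘ (+ a) 0) (mkℚᵘ (+ b) 0))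

  +a/d≡1/d*a : ∀ a d .{{_ : ℕ.NonZero d}} → + a / d ≡ (+ 1 / d) * ℕtoℚ a
  +a/d≡1/d*a a (suc d) = ≡.trans (fromℚᵘ-cong {mkℚᵘ (+ a) d} {mkℚᵘ (+ 1) d ℚᵘ.* mkℚᵘ (+ a) 0} (*≡* eq))
                                 (fromℚᵘ-homo-* (mkℚᵘ (+ 1) d) (mkℚᵘ (+ a) 0))
    where
    eq : + a ℤ.* + (suc d ℕ.* 1) ≡ (+ 1 ℤ.* + a) ℤ.* + suc d
    eq = ≡.cong₂ (λ x y → x ℤ.* + y) (≡.sym (ℤ.*-identityˡ (+ a))) (ℕ.*-identityʳ (suc d))

module StirlingBinomial where

  open import Data.Empty using (⊥-elim)
  open import Data.Nat.Base using (_+_; _*_; _^_; _!; _>_)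
  open import Data.Nat.Properties
  open import Data.Nat.Combinatorics
    using (_C_; nC1≡n; nCk+nC[k+1]≡[n+1]C[k+1]; nCk≡n!/k![n-k]!; k![n∸k]!∣n!; k>n⇒nCk≡0)
  open import Data.Nat.DivMod using (_/_; m/n*n≡m)
  open import Data.Nat.Solver using (module +-*-Solver)
  open import Relation.Nullary.Decidable using (yes; no)
  import Algebra.Properties.CommutativeSemiring.Exp +-*-commutativeSemiring as Exp
  import Algebra.Properties.Semiring.Mult +-*-semiring as Mult
  open +-*-Solver
  open ≡ using (_≡_; refl; cong; cong₂; sym; trans; subst)
  open ≡.≡-Reasoning

  open ℕ∑ using (∑≤)

  ×≡* : ∀ n x → n Mult.× x ≡ n * x
  ×≡* zero    x = refl
  ×≡* (suc n) x = cong (x +_) (×≡* n x)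

  ^≡^ : ∀ x n → x Exp.^ n ≡ x ^ n
  ^≡^ x zero    = refl
  ^≡^ x (suc n) = cong (x *_) (^≡^ x n)

  binomial-theorem : ∀ n x y → (x + y) ^ n ≡ ∑≤ n (λ k → (n C k) * (x ^ k * y ^ (n ∸ k)))
  binomial-theorem n x y = begin
    (x + y) ^ n                ≡⟨ ^≡^ (x + y) n ⟨
    (x + y) Exp.^ n            ≡⟨ ℕ∑.binomial-theorem n x y ⟩
    ∑≤ n (λ k → (n C k) Mult.× (x Exp.^ k * y Exp.^ (n ∸ k)))
      ≡⟨ ℕ∑.∑≤-cong (λ k _ → trans (×≡* (n C k) _) (cong ((n C k) *_) (cong₂ _*_ (^≡^ x k) (^≡^ y (n ∸ k))))) ⟩
    ∑≤ n (λ k → (n C k) * (x ^ k * y ^ (n ∸ k))) ∎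

  ^-distribʳ-* : ∀ x y n → (x * y) ^ n ≡ x ^ n * y ^ n
  ^-distribʳ-* x y n = begin
    (x * y) ^ n              ≡⟨ ^≡^ (x * y) n ⟨
    (x * y) Exp.^ n          ≡⟨ Exp.^-distrib-* x y n ⟩
    x Exp.^ n * y Exp.^ n    ≡⟨ cong₂ _*_ (^≡^ x n) (^≡^ y n) ⟩
    x ^ n * y ^ n            ∎

  n*nCk≡[1+k]*nC[1+k]+k*nCk : ∀ n k → n * (n C k) ≡ suc k * (n C suc k) + k * (n C k)
  n*nCk≡[1+k]*nC[1+k]+k*nCk zero    zero    = refl
  n*nCk≡[1+k]*nC[1+k]+k*nCk zero    (suc k) = sym (cong₂ _+_ (*-zeroʳ (suc (suc k))) (*-zeroʳ (suc k)))
  n*nCk≡[1+k]*nC[1+k]+k*nCk (suc n) zero    = begin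
    suc n * 1      ≡⟨ *-identityʳ (suc n) ⟩
    suc n          ≡⟨ nC1≡n (suc n) ⟨
    suc n C 1      ≡⟨ solve 1 (λ x → x := con 1 :* x :+ con 0) refl (suc n C 1) ⟩
    1 * (suc n C 1) + 0 ∎
  n*nCk≡[1+k]*nC[1+k]+k*nCk (suc n) (suc k) = begin
    suc n * (suc n C suc k)
      ≡⟨ cong (suc n *_) (nCk+nC[k+1]≡[n+1]C[k+1] n k) ⟨
    suc n * (a + b)
      ≡⟨ solve 3 (λ n a b → (con 1 :+ n) :* (a :+ b) := (a :+ b) :+ (n :* a :+ n :* b)) refl n a b ⟩
    (a + b) + (n * a + n * b)
      ≡⟨ cong ((a + b) +_) (cong₂ _+_ (n*nCk≡[1+k]*nC[1+k]+k*nCk n k)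
                                      (n*nCk≡[1+k]*nC[1+k]+k*nCk n (suc k))) ⟩
    (a + b) + ((suc k * b + k * a) + (suc (suc k) * c + suc k * b))
      ≡⟨ solve 4 (λ k a b c → (a :+ b) :+ (((con 1 :+ k) :* b :+ k :* a) :+ ((con 2 :+ k) :* c :+ (con 1 :+ k) :* b))
                             := (con 2 :+ k) :* (b :+ c) :+ (con 1 :+ k) :* (a :+ b)) refl k a b c ⟩
    suc (suc k) * (b + c) + suc k * (a + b)
      ≡⟨ cong₂ (λ u v → suc (suc k) * u + suc k * v) (nCk+nC[k+1]≡[n+1]C[k+1] n (suc k))
                                                     (nCk+nC[k+1]≡[n+1]C[k+1] n k) ⟩
    suc (suc k) * (suc n C suc (suc k)) + suc k * (suc n C suc k) ∎
    where
    a = n C k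
    b = n C suc k
    c = n C suc (suc k)

  falling : ℕ → ℕ → ℕ
  falling n k = k ! * (n C k)

  n*falling≡falling[1+k]+k*falling : ∀ n k → n * falling n k ≡ falling n (suc k) + k * falling n k
  n*falling≡falling[1+k]+k*falling n k = begin
    n * (k ! * (n C k))
      ≡⟨ solve 3 (λ n f c → n :* (f :* c) := f :* (n :* c)) refl n (k !) (n C k) ⟩
    k ! * (n * (n C k))
      ≡⟨ cong (k ! *_) (n*nCk≡[1+k]*nC[1+k]+k*nCk n k) ⟩
    k ! * (suc k * (n C suc k) + k * (n C k))
      ≡⟨ solve 5 (λ f k₁ c₁ k c → f :* (k₁ :* c₁ :+ k :* c) := (k₁ :* f) :* c₁ :+ k :* (f :* c))
                 refl (k !) (suc k) (n C suc k) k (n C k) ⟩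
    falling n (suc k) + k * falling n k ∎

  stirling2-< : ∀ {a s} → a < s → stirling2 a s ≡ 0
  stirling2-< {zero}  {suc s} _ = refl
  stirling2-< {suc a} {suc s} (s≤s a<s)
    rewrite stirling2-< a<s | stirling2-< (m≤n⇒m≤1+n a<s) = *-zeroʳ (suc s)

  ∑stirling2*falling≡^ : ∀ n a L → a ≤ L → ∑≤ L (λ k → stirling2 a k * falling n k) ≡ n ^ a
  ∑stirling2*falling≡^ n zero    L       _         = ℕ∑.∑≤-single (λ k → stirling2 0 k * falling n k) z≤n off
    where
    off : ∀ k → k ≤ L → k ≢ 0 → stirling2 0 k * falling n k ≡ 0
    off zero    _ 0≢0 = ⊥-elim (0≢0 refl)
    off (suc k) _ _   = refl
  ∑stirling2*falling≡^ n (suc a) (suc L) (s≤s a≤L) = begin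
    ∑≤ (suc L) (λ k → stirling2 (suc a) k * falling n k)
      ≡⟨ ℕ∑.∑≤-head L _ ⟩
    ∑≤ L (λ k → (S k + suc k * S (suc k)) * falling n (suc k))
      ≡⟨ ℕ∑.∑≤-cong (λ k _ → *-distribʳ-+ (falling n (suc k)) (S k) (suc k * S (suc k))) ⟩
    ∑≤ L (λ k → S k * falling n (suc k) + suc k * S (suc k) * falling n (suc k))
      ≡⟨ ℕ∑.∑≤-distrib-+ L _ _ ⟩
    ∑≤ L (λ k → S k * falling n (suc k)) + ∑≤ L (λ k → suc k * S (suc k) * falling n (suc k))
      ≡⟨ cong₂ _+_ extend (ℕ∑.∑≤-head L (λ k → k * S k * falling n k)) ⟨
    ∑≤ (suc L) (λ k → S k * falling n (suc k)) + ∑≤ (suc L) (λ k → k * S k * falling n k)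
      ≡⟨ ℕ∑.∑≤-distrib-+ (suc L) _ _ ⟨
    ∑≤ (suc L) (λ k → S k * falling n (suc k) + k * S k * falling n k)
      ≡⟨ ℕ∑.∑≤-cong (λ k _ → step k) ⟩
    ∑≤ (suc L) (λ k → n * (S k * falling n k))
      ≡⟨ ℕ∑.*-distribˡ-∑≤ (suc L) n _ ⟨
    n * ∑≤ (suc L) (λ k → S k * falling n k)
      ≡⟨ cong (n *_) (∑stirling2*falling≡^ n a (suc L) (m≤n⇒m≤1+n a≤L)) ⟩
    n * n ^ a ∎
    where
    S = stirling2 a
    extend : ∑≤ (suc L) (λ k → S k * falling n (suc k)) ≡ ∑≤ L (λ k → S k * falling n (suc k))
    extend = begin
      ∑≤ (suc L) (λ k → S k * falling n (suc k))
        ≡⟨ ℕ∑.∑≤-suc L _ ⟩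
      ∑≤ L (λ k → S k * falling n (suc k)) + S (suc L) * falling n (suc (suc L))
        ≡⟨ cong (λ x → ∑≤ L (λ k → S k * falling n (suc k)) + x * falling n (suc (suc L))) (stirling2-< (s≤s a≤L)) ⟩
      ∑≤ L (λ k → S k * falling n (suc k)) + 0
        ≡⟨ +-identityʳ _ ⟩
      ∑≤ L (λ k → S k * falling n (suc k)) ∎
    step : ∀ k → S k * falling n (suc k) + k * S k * falling n k ≡ n * (S k * falling n k)
    step k = begin
      S k * falling n (suc k) + k * S k * falling n k
        ≡⟨ solve 4 (λ s f₁ k f → s :* f₁ :+ k :* s :* f := s :* (f₁ :+ k :* f)) refl (S k) (falling n (suc k)) k (falling n k) ⟩
      S k * (falling n (suc k) + k * falling n k)
        ≡⟨ cong (S k *_) (n*falling≡falling[1+k]+k*falling n k) ⟨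
      S k * (n * falling n k)
        ≡⟨ solve 3 (λ s n f → s :* (n :* f) := n :* (s :* f)) refl (S k) n (falling n k) ⟩
      n * (S k * falling n k) ∎

  -- l! / s! · T_{s,l}(c + 1)
  scaledT : ℕ → ℕ → ℕ → ℕ
  scaledT s l c = ∑≤ l (λ a → (l C a) * stirling2 a s * c ^ (l ∸ a))

  ∑scaledT*falling≡^ : ∀ l c n → ∑≤ l (λ s → scaledT s l c * falling n s) ≡ (n + c) ^ l
  ∑scaledT*falling≡^ l c n = begin
    ∑≤ l (λ s → scaledT s l c * falling n s)
      ≡⟨ ℕ∑.∑≤-cong (λ s _ → trans (*-comm (scaledT s l c) (falling n s)) (ℕ∑.*-distribˡ-∑≤ l (falling n s) _)) ⟩
    ∑≤ l (λ s → ∑≤ l (λ a → falling n s * term a s))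
      ≡⟨ ℕ∑.∑≤-comm l l (λ s a → falling n s * term a s) ⟩
    ∑≤ l (λ a → ∑≤ l (λ s → falling n s * term a s))
      ≡⟨ ℕ∑.∑≤-cong (λ a a≤l → inner a a≤l) ⟩
    ∑≤ l (λ a → (l C a) * (n ^ a * c ^ (l ∸ a)))
      ≡⟨ binomial-theorem l n c ⟨
    (n + c) ^ l ∎
    where
    term : ℕ → ℕ → ℕ
    term a s = (l C a) * stirling2 a s * c ^ (l ∸ a)
    inner : ∀ a → a ≤ l → ∑≤ l (λ s → falling n s * term a s) ≡ (l C a) * (n ^ a * c ^ (l ∸ a))
    inner a a≤l = begin
      ∑≤ l (λ s → falling n s * term a s)
        ≡⟨ ℕ∑.∑≤-cong (λ s _ → solve 4 (λ f b t p → f :* (b :* t :* p) := (b :* p) :* (t :* f))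
                                      refl (falling n s) (l C a) (stirling2 a s) (c ^ (l ∸ a))) ⟩
      ∑≤ l (λ s → ((l C a) * c ^ (l ∸ a)) * (stirling2 a s * falling n s))
        ≡⟨ ℕ∑.*-distribˡ-∑≤ l ((l C a) * c ^ (l ∸ a)) _ ⟨
      ((l C a) * c ^ (l ∸ a)) * ∑≤ l (λ s → stirling2 a s * falling n s)
        ≡⟨ cong (((l C a) * c ^ (l ∸ a)) *_) (∑stirling2*falling≡^ n a l a≤l) ⟩
      ((l C a) * c ^ (l ∸ a)) * n ^ a
        ≡⟨ solve 3 (λ b p q → (b :* p) :* q := b :* (q :* p)) refl (l C a) (c ^ (l ∸ a)) (n ^ a) ⟩
      (l C a) * (n ^ a * c ^ (l ∸ a)) ∎

  nCk*k!*[n∸k]!≡n! : ∀ {n k} → k ≤ n → (n C k) * (k ! * (n ∸ k) !) ≡ n !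
  nCk*k!*[n∸k]!≡n! {n} {k} k≤n = begin
    (n C k) * (k ! * (n ∸ k) !)                                    ≡⟨ cong (_* (k ! * (n ∸ k) !)) (nCk≡n!/k![n-k]! k≤n) ⟩
    (n ! / (k ! * (n ∸ k) !)) {{k!*[n∸k]!≢0}} * (k ! * (n ∸ k) !) ≡⟨ m/n*n≡m {{k!*[n∸k]!≢0}} (k![n∸k]!∣n! k≤n) ⟩
    n !                                                            ∎
    where
    k!*[n∸k]!≢0 = m*n≢0 (k !) ((n ∸ k) !) {{k !≢0}} {{(n ∸ k) !≢0}}

  [s+c]Cs*[n+c]C[c+s]≡[n+c]Cc*nCs : ∀ n c s → ((s + c) C s) * ((n + c) C (c + s)) ≡ ((n + c) C c) * (n C s)
  [s+c]Cs*[n+c]C[c+s]≡[n+c]Cc*nCs n c s with s ≤? n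
  ... | no s≰n = begin
    ((s + c) C s) * ((n + c) C (c + s)) ≡⟨ cong (((s + c) C s) *_) (k>n⇒nCk≡0 c+s>n+c) ⟩
    ((s + c) C s) * 0                   ≡⟨ *-zeroʳ ((s + c) C s) ⟩
    0                                   ≡⟨ *-zeroʳ ((n + c) C c) ⟨
    ((n + c) C c) * 0                   ≡⟨ cong (((n + c) C c) *_) (k>n⇒nCk≡0 (≰⇒> s≰n)) ⟨
    ((n + c) C c) * (n C s)             ∎
    where
    c+s>n+c : c + s > n + c
    c+s>n+c = subst (_< c + s) (+-comm c n) (+-monoʳ-< c (≰⇒> s≰n))
  ... | yes s≤n = *-cancelʳ-≡ _ _ (s ! * c ! * (n ∸ s) !) {{nonZero}} (trans lhs (sym rhs))
    where
    nonZero : ℕ.NonZero (s ! * c ! * (n ∸ s) !)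
    nonZero = m*n≢0 (s ! * c !) ((n ∸ s) !) {{m*n≢0 (s !) (c !) {{s !≢0}} {{c !≢0}}}} {{(n ∸ s) !≢0}}
    lhs : ((s + c) C s) * ((n + c) C (c + s)) * (s ! * c ! * (n ∸ s) !) ≡ (n + c) !
    lhs = begin
      ((s + c) C s) * ((n + c) C (c + s)) * (s ! * c ! * (n ∸ s) !)
        ≡⟨ solve 5 (λ x y a b d → x :* y :* (a :* b :* d) := y :* ((x :* (a :* b)) :* d))
                   refl ((s + c) C s) ((n + c) C (c + s)) (s !) (c !) ((n ∸ s) !) ⟩
      ((n + c) C (c + s)) * (((s + c) C s) * (s ! * c !) * (n ∸ s) !)
        ≡⟨ cong (λ x → ((n + c) C (c + s)) * (((s + c) C s) * (s ! * x !) * (n ∸ s) !)) (m+n∸m≡n s c) ⟨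
      ((n + c) C (c + s)) * (((s + c) C s) * (s ! * (s + c ∸ s) !) * (n ∸ s) !)
        ≡⟨ cong (λ x → ((n + c) C (c + s)) * (x * (n ∸ s) !))
                (trans (nCk*k!*[n∸k]!≡n! (m≤m+n s c)) (cong _! (+-comm s c))) ⟩
      ((n + c) C (c + s)) * ((c + s) ! * (n ∸ s) !)
        ≡⟨ cong (λ x → ((n + c) C (c + s)) * ((c + s) ! * x !)) n+c∸[c+s]≡n∸s ⟨
      ((n + c) C (c + s)) * ((c + s) ! * (n + c ∸ (c + s)) !)
        ≡⟨ nCk*k!*[n∸k]!≡n! (subst (c + s ≤_) (+-comm c n) (+-monoʳ-≤ c s≤n)) ⟩
      (n + c) !                                                   ∎
      where
      n+c∸[c+s]≡n∸s : n + c ∸ (c + s) ≡ n ∸ s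
      n+c∸[c+s]≡n∸s = trans (cong (_∸ (c + s)) (+-comm n c)) ([m+n]∸[m+o]≡n∸o c n s)
    rhs : ((n + c) C c) * (n C s) * (s ! * c ! * (n ∸ s) !) ≡ (n + c) !
    rhs = begin
      ((n + c) C c) * (n C s) * (s ! * c ! * (n ∸ s) !)
        ≡⟨ solve 5 (λ z w a b d → z :* w :* (a :* b :* d) := z :* (b :* (w :* (a :* d))))
                   refl ((n + c) C c) (n C s) (s !) (c !) ((n ∸ s) !) ⟩
      ((n + c) C c) * (c ! * ((n C s) * (s ! * (n ∸ s) !)))
        ≡⟨ cong (λ x → ((n + c) C c) * (c ! * x)) (nCk*k!*[n∸k]!≡n! s≤n) ⟩
      ((n + c) C c) * (c ! * n !)
        ≡⟨ cong (λ x → ((n + c) C c) * (c ! * x !)) (m+n∸n≡m n c) ⟨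
      ((n + c) C c) * (c ! * (n + c ∸ c) !)
        ≡⟨ nCk*k!*[n∸k]!≡n! (m≤n+m c n) ⟩
      (n + c) !                                                   ∎

  expansionTerm : ℕ → ℕ → ℕ → ℕ → ℕ
  expansionTerm l c N s = s ! * scaledT s l c * ((s + c) C s) * (N C (c + s))

  ^*C≡∑expansionTerm : ∀ l c N → N ^ l * (N C c) ≡ ∑≤ l (expansionTerm l c N)
  ^*C≡∑expansionTerm l c N with c ≤? N
  ... | no c≰N = begin
    N ^ l * (N C c) ≡⟨ cong (N ^ l *_) (k>n⇒nCk≡0 (≰⇒> c≰N)) ⟩
    N ^ l * 0       ≡⟨ *-zeroʳ (N ^ l) ⟩
    0               ≡⟨ ℕ∑.∑≤-zero (λ s _ → trans (cong (s ! * scaledT s l c * ((s + c) C s) *_)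
                                                     (k>n⇒nCk≡0 (<-≤-trans (≰⇒> c≰N) (m≤m+n c s))))
                                               (*-zeroʳ (s ! * scaledT s l c * ((s + c) C s)))) ⟨
    ∑≤ l (expansionTerm l c N) ∎
  ... | yes c≤N = subst (λ N → N ^ l * (N C c) ≡ ∑≤ l (expansionTerm l c N))
                        (m∸n+n≡m c≤N) (sym (expansion (N ∸ c)))
    where
    expansion : ∀ n → ∑≤ l (expansionTerm l c (n + c)) ≡ (n + c) ^ l * ((n + c) C c)
    expansion n = begin
      ∑≤ l (expansionTerm l c (n + c))
        ≡⟨ ℕ∑.∑≤-cong (λ s _ → term s) ⟩
      ∑≤ l (λ s → ((n + c) C c) * (scaledT s l c * falling n s))
        ≡⟨ ℕ∑.*-distribˡ-∑≤ l ((n + c) C c) _ ⟨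
      ((n + c) C c) * ∑≤ l (λ s → scaledT s l c * falling n s)
        ≡⟨ cong (((n + c) C c) *_) (∑scaledT*falling≡^ l c n) ⟩
      ((n + c) C c) * (n + c) ^ l
        ≡⟨ *-comm ((n + c) C c) ((n + c) ^ l) ⟩
      (n + c) ^ l * ((n + c) C c) ∎
      where
      term : ∀ s → expansionTerm l c (n + c) s ≡ ((n + c) C c) * (scaledT s l c * falling n s)
      term s = begin
        s ! * scaledT s l c * ((s + c) C s) * ((n + c) C (c + s))
          ≡⟨ solve 4 (λ f t x y → f :* t :* x :* y := f :* t :* (x :* y))
                     refl (s !) (scaledT s l c) ((s + c) C s) ((n + c) C (c + s)) ⟩
        s ! * scaledT s l c * (((s + c) C s) * ((n + c) C (c + s)))
          ≡⟨ cong (s ! * scaledT s l c *_) ([s+c]Cs*[n+c]C[c+s]≡[n+c]Cc*nCs n c s) ⟩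
        s ! * scaledT s l c * (((n + c) C c) * (n C s))
          ≡⟨ solve 4 (λ f t z w → f :* t :* (z :* w) := z :* (t :* (f :* w)))
                     refl (s !) (scaledT s l c) ((n + c) C c) (n C s) ⟩
        ((n + c) C c) * (scaledT s l c * falling n s) ∎

module ℚ∑ = RangeSum (CommutativeRing.commutativeSemiring ℚ.+-*-commutativeRing)

module Coefficients where

  open import Data.Empty using (⊥-elim)
  open import Data.Nat.Base using (_+_; _^_)
  open import Data.Nat.Properties using (_≟_; _≤?_; ≤-<-trans; ≰⇒>; <⇒≢; m≤m+n; m+n∸m≡n; m+[n∸m]≡n; m∸n+n≡m;
                                         [m+n]∸[m+o]≡n∸o; +-suc; *-monoˡ-<; *-distribʳ-+)
  open import Data.Nat.Combinatorics using (_C_; nCn≡1; nCk+nC[k+1]≡[n+1]C[k+1]; k>n⇒nCk≡0)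
  open import Data.Nat.Divisibility using (_∣_; _∣?_; divides; _∣0; ∣-refl; n∣m*n; ∣⇒≤; ∣m∣n⇒∣m+n; ∣m+n∣m⇒∣n)
  open import Data.Rational.Base using (0ℚ; 1ℚ; _*_)
  open import Data.Rational.Properties using (+-identityˡ; *-identityˡ; *-zeroˡ; *-zeroʳ; *-assoc)
  open import Relation.Nullary using (¬_; yes; no)
  open NatCast
  open StirlingBinomial using (scaledT; stirling2-<; expansionTerm; ^-distribʳ-*)
  open ℚ∑ using (∑≤)
  open ≡ using (_≡_; refl; cong; cong₂; sym; trans)
  open ≡.≡-Reasoning

  sumTo≡∑≤ : ∀ n f → sumTo n f ≡ ∑≤ n f
  sumTo≡∑≤ zero    f = sym (ℚ∑.∑≤-0 f)
  sumTo≡∑≤ (suc n) f = trans (cong (ℚ._+ f (suc n)) (sumTo≡∑≤ n f)) (sym (ℚ∑.∑≤-suc n f))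

  *-distribˡ-sumTo : ∀ n x f → sumTo n (λ i → x * f i) ≡ x * sumTo n f
  *-distribˡ-sumTo n x f = begin
    sumTo n (λ i → x * f i) ≡⟨ sumTo≡∑≤ n _ ⟩
    ∑≤ n (λ i → x * f i)    ≡⟨ ℚ∑.*-distribˡ-∑≤ n x f ⟨
    x * ∑≤ n f              ≡⟨ cong (x *_) (sumTo≡∑≤ n f) ⟨
    x * sumTo n f           ∎

  sumTo-ℕtoℚ : ∀ n f → sumTo n (λ i → ℕtoℚ (f i)) ≡ ℕtoℚ (ℕ∑.∑≤ n f)
  sumTo-ℕtoℚ zero    f = cong ℕtoℚ (sym (ℕ∑.∑≤-0 f))
  sumTo-ℕtoℚ (suc n) f = begin
    sumTo n (λ i → ℕtoℚ (f i)) ℚ.+ ℕtoℚ (f (suc n)) ≡⟨ cong (ℚ._+ ℕtoℚ (f (suc n))) (sumTo-ℕtoℚ n f) ⟩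
    ℕtoℚ (ℕ∑.∑≤ n f) ℚ.+ ℕtoℚ (f (suc n))          ≡⟨ ℕtoℚ-homo-+ (ℕ∑.∑≤ n f) (f (suc n)) ⟨
    ℕtoℚ (ℕ∑.∑≤ n f ℕ.+ f (suc n))                ≡⟨ cong ℕtoℚ (ℕ∑.∑≤-suc n f) ⟨
    ℕtoℚ (ℕ∑.∑≤ (suc n) f)                        ∎

  *-ℕtoℚ-assoc : ∀ q x y → q * ℕtoℚ x * ℕtoℚ y ≡ q * ℕtoℚ (x ℕ.* y)
  *-ℕtoℚ-assoc q x y = trans (*-assoc q (ℕtoℚ x) (ℕtoℚ y)) (cong (q *_) (sym (ℕtoℚ-homo-* x y)))

  x≡0⇒x*y≡0 : ∀ {x} y → x ≡ 0ℚ → x * y ≡ 0ℚ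
  x≡0⇒x*y≡0 y refl = *-zeroˡ y

  iterate-θ : ∀ l f n → iterate l θ f n ≡ ℕtoℚ (n ^ l) * f n
  iterate-θ zero    f n = sym (*-identityˡ (f n))
  iterate-θ (suc l) f n = begin
    ℕtoℚ n * iterate l θ f n      ≡⟨ cong (ℕtoℚ n *_) (iterate-θ l f n) ⟩
    ℕtoℚ n * (ℕtoℚ (n ^ l) * f n) ≡⟨ *-assoc (ℕtoℚ n) (ℕtoℚ (n ^ l)) (f n) ⟨
    ℕtoℚ n * ℕtoℚ (n ^ l) * f n   ≡⟨ cong (_* f n) (ℕtoℚ-homo-* n (n ^ l)) ⟨
    ℕtoℚ (n ^ suc l) * f n        ∎

  qpow-≢ : ∀ a i → i ≢ a → qpow a i ≡ 0ℚ
  qpow-≢ a i i≢a with i ≟ a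
  ... | yes i≡a = ⊥-elim (i≢a i≡a)
  ... | no  _   = refl

  qpow-≡ : ∀ a → qpow a a ≡ 1ℚ
  qpow-≡ a with a ≟ a
  ... | yes _   = refl
  ... | no  a≢a = ⊥-elim (a≢a refl)

  geom-∣ : ∀ m n → m ∣ n → geom m n ≡ 1ℚ
  geom-∣ m n m∣n with m ∣? n
  ... | yes _   = refl
  ... | no  m∤n = ⊥-elim (m∤n m∣n)

  geom-∤ : ∀ m n → ¬ m ∣ n → geom m n ≡ 0ℚ
  geom-∤ m n m∤n with m ∣? n
  ... | yes m∣n = ⊥-elim (m∤n m∣n)
  ... | no  _   = refl

  geom-periodic : ∀ m i → geom m (m + i) ≡ geom m i
  geom-periodic m i with m ∣? i
  ... | yes m∣i = geom-∣ m (m + i) (∣m∣n⇒∣m+n ∣-refl m∣i)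
  ... | no  m∤i = geom-∤ m (m + i) (λ m∣m+i → m∤i (∣m+n∣m⇒∣n m∣m+i ∣-refl))

  SupportedOnMultiplesOf : ℕ → FPS → Set
  SupportedOnMultiplesOf m f = ∀ n → ¬ m ∣ n → f n ≡ 0ℚ

  qpow-supported : ∀ {m a} → m ∣ a → SupportedOnMultiplesOf m (qpow a)
  qpow-supported {a = a} m∣a n m∤n = qpow-≢ a n (λ { refl → m∤n m∣a })

  geom-supported : ∀ m → SupportedOnMultiplesOf m (geom m)
  geom-supported = geom-∤

  ⊛-supported : ∀ {m f g} → SupportedOnMultiplesOf m f → SupportedOnMultiplesOf m g → SupportedOnMultiplesOf m (f ⊛ g)
  ⊛-supported {m} {f} {g} f-supp g-supp n m∤n = trans (sumTo≡∑≤ n _) (ℚ∑.∑≤-zero term)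
    where
    term : ∀ i → i ≤ n → f i * g (n ∸ i) ≡ 0ℚ
    term i i≤n with m ∣? i
    ... | no  m∤i = x≡0⇒x*y≡0 (g (n ∸ i)) (f-supp i m∤i)
    ... | yes m∣i = trans (cong (f i *_) (g-supp (n ∸ i) m∤n∸i)) (*-zeroʳ (f i))
      where
      m∤n∸i : ¬ m ∣ n ∸ i
      m∤n∸i m∣n∸i = m∤n (≡.subst (m ∣_) (m+[n∸m]≡n i≤n) (∣m∣n⇒∣m+n m∣i m∣n∸i))

  ^ˢ-supported : ∀ {m f} b → SupportedOnMultiplesOf m f → SupportedOnMultiplesOf m (f ^ˢ b)
  ^ˢ-supported {m} zero    _      = qpow-supported (m ∣0)
  ^ˢ-supported     (suc b) f-supp = ⊛-supported f-supp (^ˢ-supported b f-supp)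

  Q-supported : ∀ a b m → SupportedOnMultiplesOf m (Q a b m)
  Q-supported a b m = ⊛-supported (qpow-supported (n∣m*n a)) (^ˢ-supported b (geom-supported m))

  ·-supported : ∀ {m} x f → SupportedOnMultiplesOf m f → SupportedOnMultiplesOf m (x · f)
  ·-supported x f f-supp n m∤n = trans (cong (x *_) (f-supp n m∤n)) (*-zeroʳ x)

  iterate-θ-supported : ∀ {m f} l → SupportedOnMultiplesOf m f → SupportedOnMultiplesOf m (iterate l θ f)
  iterate-θ-supported         zero    f-supp   = f-supp
  iterate-θ-supported {f = f} (suc l) f-supp n = ·-supported (ℕtoℚ n) (iterate l θ f) (iterate-θ-supported l f-supp) n

  sumSeries-supported : ∀ {m} l F → (∀ s → SupportedOnMultiplesOf m (F s)) → SupportedOnMultiplesOf m (sumSeries l F)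
  sumSeries-supported l F F-supp n m∤n = trans (sumTo≡∑≤ l _) (ℚ∑.∑≤-zero (λ s _ → F-supp s n m∤n))

  supported-≡ : ∀ {m f g} → SupportedOnMultiplesOf m f → SupportedOnMultiplesOf m g →
                (∀ N → f (N ℕ.* m) ≡ g (N ℕ.* m)) → ∀ n → f n ≡ g n
  supported-≡ {m} f-supp g-supp agree n with m ∣? n
  ... | yes (divides N refl) = agree N
  ... | no  m∤n              = trans (f-supp n m∤n) (sym (g-supp n m∤n))

  qpow⊛-< : ∀ a g {n} → n < a → (qpow a ⊛ g) n ≡ 0ℚ
  qpow⊛-< a g {n} n<a = trans (sumTo≡∑≤ n _) (ℚ∑.∑≤-zero (λ i i≤n →
    x≡0⇒x*y≡0 (g (n ∸ i)) (qpow-≢ a i (<⇒≢ (≤-<-trans i≤n n<a)))))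

  qpow⊛-+ : ∀ a g t → (qpow a ⊛ g) (a + t) ≡ g t
  qpow⊛-+ a g t = begin
    sumTo (a + t) (λ i → qpow a i * g (a + t ∸ i))
      ≡⟨ sumTo≡∑≤ (a + t) _ ⟩
    ∑≤ (a + t) (λ i → qpow a i * g (a + t ∸ i))
      ≡⟨ ℚ∑.∑≤-single _ (m≤m+n a t) (λ i _ i≢a → x≡0⇒x*y≡0 (g (a + t ∸ i)) (qpow-≢ a i i≢a)) ⟩
    qpow a a * g (a + t ∸ a)
      ≡⟨ cong₂ _*_ (qpow-≡ a) (cong g (m+n∸m≡n a t)) ⟩
    1ℚ * g t
      ≡⟨ *-identityˡ (g t) ⟩
    g t ∎

  geom⊛-+ : ∀ m g n → (geom (suc m) ⊛ g) (suc m + n) ≡ g (suc m + n) ℚ.+ (geom (suc m) ⊛ g) n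
  geom⊛-+ m g n = begin
    (geom (suc m) ⊛ g) (suc m + n)
      ≡⟨ sumTo≡∑≤ (suc m + n) _ ⟩
    ∑≤ (suc m + n) (λ i → geom (suc m) i * g (suc m + n ∸ i))
      ≡⟨ ℚ∑.∑≤-split m n _ ⟩
    ∑≤ m (λ i → geom (suc m) i * g (suc m + n ∸ i))
      ℚ.+ ∑≤ n (λ i → geom (suc m) (suc m + i) * g (suc m + n ∸ (suc m + i)))
      ≡⟨ cong₂ ℚ._+_ (ℚ∑.∑≤-single _ z≤n (λ i i≤m i≢0 →
                        x≡0⇒x*y≡0 (g (suc m + n ∸ i)) (geom-∤ (suc m) i (small i≤m i≢0))))
                     (ℚ∑.∑≤-cong (λ i _ →
                        cong₂ _*_ (geom-periodic (suc m) i) (cong g ([m+n]∸[m+o]≡n∸o (suc m) n i)))) ⟩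
    geom (suc m) 0 * g (suc m + n) ℚ.+ ∑≤ n (λ i → geom (suc m) i * g (n ∸ i))
      ≡⟨ cong₂ ℚ._+_ (trans (cong (_* g (suc m + n)) (geom-∣ (suc m) 0 (suc m ∣0))) (*-identityˡ (g (suc m + n))))
                      (sym (sumTo≡∑≤ n _)) ⟩
    g (suc m + n) ℚ.+ (geom (suc m) ⊛ g) n ∎
    where
    small : ∀ {i} → i ≤ m → i ≢ 0 → ¬ suc m ∣ i
    small {zero}  _   0≢0    = ⊥-elim (0≢0 refl)
    small {suc i} i≤m _ m+1∣i = ℕ.1+n≰n (ℕ.≤-trans (s≤s i≤m) (∣⇒≤ m+1∣i))

  geom^ˢ-0 : ∀ m b → (geom m ^ˢ b) 0 ≡ 1ℚ
  geom^ˢ-0 m zero    = qpow-≡ 0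
  geom^ˢ-0 m (suc b) = cong₂ _*_ (geom-∣ m 0 (m ∣0)) (geom^ˢ-0 m b)

  geom^ˢ-* : ∀ m b t → (geom (suc m) ^ˢ suc b) (t ℕ.* suc m) ≡ ℕtoℚ ((t + b) C b)
  geom^ˢ-* m b       zero    = trans (geom^ˢ-0 (suc m) (suc b)) (cong ℕtoℚ (sym (nCn≡1 b)))
  geom^ˢ-* m zero    (suc t) = begin
    (geom (suc m) ^ˢ 1) (suc m + t ℕ.* suc m)
      ≡⟨ geom⊛-+ m (qpow 0) (t ℕ.* suc m) ⟩
    qpow 0 (suc m + t ℕ.* suc m) ℚ.+ (geom (suc m) ^ˢ 1) (t ℕ.* suc m)
      ≡⟨ cong₂ ℚ._+_ (qpow-≢ 0 (suc m + t ℕ.* suc m) (λ ())) (geom^ˢ-* m zero t) ⟩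
    0ℚ ℚ.+ ℕtoℚ ((t + 0) C 0)
      ≡⟨ +-identityˡ _ ⟩
    ℕtoℚ ((suc t + 0) C 0) ∎
  geom^ˢ-* m (suc b) (suc t) = begin
    (geom (suc m) ^ˢ suc (suc b)) (suc m + t ℕ.* suc m)
      ≡⟨ geom⊛-+ m (geom (suc m) ^ˢ suc b) (t ℕ.* suc m) ⟩
    (geom (suc m) ^ˢ suc b) (suc t ℕ.* suc m) ℚ.+ (geom (suc m) ^ˢ suc (suc b)) (t ℕ.* suc m)
      ≡⟨ cong₂ ℚ._+_ (geom^ˢ-* m b (suc t)) (geom^ˢ-* m (suc b) t) ⟩
    ℕtoℚ ((suc t + b) C b) ℚ.+ ℕtoℚ ((t + suc b) C suc b)
      ≡⟨ ℕtoℚ-homo-+ ((suc t + b) C b) ((t + suc b) C suc b) ⟨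
    ℕtoℚ ((suc t + b) C b ℕ.+ (t + suc b) C suc b)
      ≡⟨ cong ℕtoℚ pascal ⟩
    ℕtoℚ ((suc t + suc b) C suc b) ∎
    where
    pascal : (suc t + b) C b ℕ.+ (t + suc b) C suc b ≡ (suc t + suc b) C suc b
    pascal rewrite +-suc t b = nCk+nC[k+1]≡[n+1]C[k+1] (suc (t + b)) b

  Q-* : ∀ m a N → Q a (suc a) (suc m) (N ℕ.* suc m) ≡ ℕtoℚ (N C a)
  Q-* m a N with a ≤? N
  ... | no  a≰N = begin
    Q a (suc a) (suc m) (N ℕ.* suc m)
      ≡⟨ qpow⊛-< (a ℕ.* suc m) (geom (suc m) ^ˢ suc a) (*-monoˡ-< (suc m) (≰⇒> a≰N)) ⟩
    0ℚ
      ≡⟨ cong ℕtoℚ (k>n⇒nCk≡0 (≰⇒> a≰N)) ⟨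
    ℕtoℚ (N C a) ∎
  ... | yes a≤N = begin
    Q a (suc a) (suc m) (N ℕ.* suc m)
      ≡⟨ cong (Q a (suc a) (suc m)) N*m≡a*m+[N∸a]*m ⟩
    (qpow (a ℕ.* suc m) ⊛ (geom (suc m) ^ˢ suc a)) (a ℕ.* suc m + (N ∸ a) ℕ.* suc m)
      ≡⟨ qpow⊛-+ (a ℕ.* suc m) (geom (suc m) ^ˢ suc a) ((N ∸ a) ℕ.* suc m) ⟩
    (geom (suc m) ^ˢ suc a) ((N ∸ a) ℕ.* suc m)
      ≡⟨ geom^ˢ-* m a (N ∸ a) ⟩
    ℕtoℚ ((N ∸ a + a) C a)
      ≡⟨ cong (λ x → ℕtoℚ (x C a)) (m∸n+n≡m a≤N) ⟩
    ℕtoℚ (N C a) ∎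
    where
    N*m≡a*m+[N∸a]*m : N ℕ.* suc m ≡ a ℕ.* suc m + (N ∸ a) ℕ.* suc m
    N*m≡a*m+[N∸a]*m = trans (cong (ℕ._* suc m) (sym (m+[n∸m]≡n a≤N))) (*-distribʳ-+ (suc m) a (N ∸ a))

  iterate-θ-Q-* : ∀ l m a N →
    iterate l θ (Q a (suc a) (suc m)) (N ℕ.* suc m) ≡ ℕtoℚ (suc m ^ l) * ℕtoℚ (N ^ l ℕ.* (N C a))
  iterate-θ-Q-* l m a N = begin
    iterate l θ (Q a (suc a) (suc m)) (N ℕ.* suc m)
      ≡⟨ iterate-θ l _ (N ℕ.* suc m) ⟩
    ℕtoℚ ((N ℕ.* suc m) ^ l) * Q a (suc a) (suc m) (N ℕ.* suc m)
      ≡⟨ cong₂ _*_ (cong ℕtoℚ (trans (cong (_^ l) (ℕ.*-comm N (suc m))) (^-distribʳ-* (suc m) N l))) (Q-* m a N) ⟩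
    ℕtoℚ (suc m ^ l ℕ.* N ^ l) * ℕtoℚ (N C a)
      ≡⟨ cong (_* ℕtoℚ (N C a)) (ℕtoℚ-homo-* (suc m ^ l) (N ^ l)) ⟩
    ℕtoℚ (suc m ^ l) * ℕtoℚ (N ^ l) * ℕtoℚ (N C a)
      ≡⟨ *-ℕtoℚ-assoc (ℕtoℚ (suc m ^ l)) (N ^ l) (N C a) ⟩
    ℕtoℚ (suc m ^ l) * ℕtoℚ (N ^ l ℕ.* (N C a)) ∎

  T≡1/l!*s!*scaledT : ∀ {s l} c → s ≤ l → T s l (suc c) ≡ invFact l * ℕtoℚ (s ℕ.! ℕ.* scaledT s l c)
  T≡1/l!*s!*scaledT {s} {l} c s≤l = begin
    T s l (suc c)
      ≡⟨ cong₂ _*_ (+a/d≡1/d*a (s ℕ.!) (l ℕ.!) {{l ℕ.!≢0}}) (sumTo-ℕtoℚ (l ∸ s) (λ i → term (s + i))) ⟩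
    invFact l * ℕtoℚ (s ℕ.!) * ℕtoℚ (ℕ∑.∑≤ (l ∸ s) (λ i → term (s + i)))
      ≡⟨ cong (λ x → invFact l * ℕtoℚ (s ℕ.!) * ℕtoℚ x) (ℕ∑.∑≤-from term s≤l vanish) ⟩
    invFact l * ℕtoℚ (s ℕ.!) * ℕtoℚ (scaledT s l c)
      ≡⟨ *-ℕtoℚ-assoc (invFact l) (s ℕ.!) (scaledT s l c) ⟩
    invFact l * ℕtoℚ (s ℕ.! ℕ.* scaledT s l c) ∎
    where
    term : ℕ → ℕ
    term a = (l C a) ℕ.* stirling2 a s ℕ.* c ^ (l ∸ a)
    vanish : ∀ a → a < s → term a ≡ 0
    vanish a a<s = trans (cong (λ x → (l C a) ℕ.* x ℕ.* c ^ (l ∸ a)) (stirling2-< a<s))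
                         (cong (ℕ._* c ^ (l ∸ a)) (ℕ.*-zeroʳ (l C a)))

  summand-* : ∀ {s l} c m N → s ≤ l →
    (T s l (suc c) * ℕtoℚ ((s + suc c ∸ 1) C s)) * Q (c + s) (suc (c + s)) (suc m) (N ℕ.* suc m)
      ≡ invFact l * ℕtoℚ (expansionTerm l c N s)
  summand-* {s} {l} c m N s≤l = begin
    (T s l (suc c) * ℕtoℚ ((s + suc c ∸ 1) C s)) * Q (c + s) (suc (c + s)) (suc m) (N ℕ.* suc m)
      ≡⟨ cong₂ _*_ (cong₂ _*_ (T≡1/l!*s!*scaledT c s≤l) (cong (λ x → ℕtoℚ ((x ∸ 1) C s)) (+-suc s c))) (Q-* m (c + s) N) ⟩
    invFact l * ℕtoℚ (s ℕ.! ℕ.* scaledT s l c) * ℕtoℚ ((s + c) C s) * ℕtoℚ (N C (c + s))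
      ≡⟨ cong (_* ℕtoℚ (N C (c + s))) (*-ℕtoℚ-assoc (invFact l) (s ℕ.! ℕ.* scaledT s l c) ((s + c) C s)) ⟩
    invFact l * ℕtoℚ (s ℕ.! ℕ.* scaledT s l c ℕ.* ((s + c) C s)) * ℕtoℚ (N C (c + s))
      ≡⟨ *-ℕtoℚ-assoc (invFact l) (s ℕ.! ℕ.* scaledT s l c ℕ.* ((s + c) C s)) (N C (c + s)) ⟩
    invFact l * ℕtoℚ (expansionTerm l c N s) ∎

  ∑summand-* : ∀ l c m N →
    sumTo l (λ s → (T s l (suc c) * ℕtoℚ ((s + suc c ∸ 1) C s)) * Q (c + s) (suc (c + s)) (suc m) (N ℕ.* suc m))
      ≡ invFact l * ℕtoℚ (ℕ∑.∑≤ l (expansionTerm l c N))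
  ∑summand-* l c m N = begin
    sumTo l (λ s → (T s l (suc c) * ℕtoℚ ((s + suc c ∸ 1) C s)) * Q (c + s) (suc (c + s)) (suc m) (N ℕ.* suc m))
      ≡⟨ sumTo≡∑≤ l _ ⟩
    ∑≤ l (λ s → (T s l (suc c) * ℕtoℚ ((s + suc c ∸ 1) C s)) * Q (c + s) (suc (c + s)) (suc m) (N ℕ.* suc m))
      ≡⟨ ℚ∑.∑≤-cong (λ s s≤l → summand-* c m N s≤l) ⟩
    ∑≤ l (λ s → invFact l * ℕtoℚ (expansionTerm l c N s))
      ≡⟨ sumTo≡∑≤ l _ ⟨
    sumTo l (λ s → invFact l * ℕtoℚ (expansionTerm l c N s))
      ≡⟨ *-distribˡ-sumTo l (invFact l) _ ⟩
    invFact l * sumTo l (λ s → ℕtoℚ (expansionTerm l c N s))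
      ≡⟨ cong (invFact l *_) (sumTo-ℕtoℚ l (expansionTerm l c N)) ⟩
    invFact l * ℕtoℚ (ℕ∑.∑≤ l (expansionTerm l c N)) ∎

open import Data.Nat using (ℕ; _≥_; _∸_; _+_; _^_)
open import Data.Nat.Combinatorics using (_C_)
open import Data.Rational using (_*_)
open import Relation.Binary.PropositionalEquality using (_≡_)

open import Algebra.Bundles using (CommutativeMonoid)
open import Algebra.Properties.CommutativeSemigroup (CommutativeMonoid.commutativeSemigroup ℚ.*-1-commutativeMonoid)
  using (x∙yz≈y∙xz)
open Coefficients
  using (supported-≡; Q-supported; ·-supported; iterate-θ-supported; sumSeries-supported; iterate-θ-Q-*; ∑summand-*)
open StirlingBinomial using (^*C≡∑expansionTerm; expansionTerm)
open ≡.≡-Reasoning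

lemmaA5 : (l k m : ℕ) → k ≥ 1 → m ≥ 1 → (n : ℕ) →
    (invFact l · iterate l θ (Q (k ∸ 1) k m)) n
      ≡ (ℕtoℚ (m ^ l) · sumSeries l (λ s →
           (T s l k * ℕtoℚ ((s + k ∸ 1) C s)) · Q (k + s ∸ 1) (k + s) m)) n
lemmaA5 l zero    _       () _
lemmaA5 l (suc c) zero    _  ()
lemmaA5 l (suc c) (suc m) _  _ =
  supported-≡ (·-supported (invFact l) _ (iterate-θ-supported l (Q-supported c (suc c) (suc m))))
              (·-supported (ℕtoℚ (suc m ^ l)) _ (sumSeries-supported l _ (λ s →
                 ·-supported (T s l (suc c) * ℕtoℚ ((s + suc c ∸ 1) C s)) _ (Q-supported (c + s) (suc (c + s)) (suc m)))))
              λ N → begin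
  invFact l * iterate l θ (Q c (suc c) (suc m)) (N ℕ.* suc m)
    ≡⟨ ≡.cong (invFact l *_) (iterate-θ-Q-* l m c N) ⟩
  invFact l * (ℕtoℚ (suc m ^ l) * ℕtoℚ (N ^ l ℕ.* (N C c)))
    ≡⟨ x∙yz≈y∙xz (invFact l) (ℕtoℚ (suc m ^ l)) (ℕtoℚ (N ^ l ℕ.* (N C c))) ⟩
  ℕtoℚ (suc m ^ l) * (invFact l * ℕtoℚ (N ^ l ℕ.* (N C c)))
    ≡⟨ ≡.cong (λ x → ℕtoℚ (suc m ^ l) * (invFact l * ℕtoℚ x)) (^*C≡∑expansionTerm l c N) ⟩
  ℕtoℚ (suc m ^ l) * (invFact l * ℕtoℚ (ℕ∑.∑≤ l (expansionTerm l c N)))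
    ≡⟨ ≡.cong (ℕtoℚ (suc m ^ l) *_) (≡.sym (∑summand-* l c m N)) ⟩
  ℕtoℚ (suc m ^ l) * sumTo l (λ s →
    (T s l (suc c) * ℕtoℚ ((s + suc c ∸ 1) C s)) * Q (c + s) (suc (c + s)) (suc m) (N ℕ.* suc m)) ∎
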